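{- Let $k>1$ and let $J\subseteq C(n,k)$ be a realizable $k$-set. The map sending a path from $\emptyset$ to $J$ in $B(n,k-1)$ (i.e. a total order on $J$ all of whose prefixes are realizable $k$-sets) to the total order it induces on $J$ is a bijection between the set of such paths and the set $A_J(n,k)$ of admissible $J$-orders.
   Context: $C(n,k)$: $k$-element subsets of $\{1,\dots,n\}$ with lexicographic order (increasing sequences compared lexicographically); antilexicographic = reverse. For $X\in C(n,k+1)$, $P_X=\{Y\in C(n,k):Y\subset X\}$ with induced lexicographic order. Prefix/suffix = initial/final segment (possibly empty or all). For $A\subseteq C(n,k)$: $A_p$ (resp. $A_s$) = $\{X\in C(n,k+1): P_X\cap A$ a nonempty prefix (resp. suffix) of $P_X$, $\ne P_X\}$, $A_F=\{X:P_X\subseteq A\}$, $A_\emptyset=\{X:P_X\cap A=\emptyset\}$; $A$ is realizable if each $P_X\cap A$ is a prefix or suffix of $P_X$. By Ziegler's theorem the higher Bruhat order $B(n,k-1)$ is isomorphic to the poset of realizable subsets of $C(n,k)$ under single-step inclusion; accordingly a path from $\emptyset$ to $J$ in $B(n,k-1)$ is a chain $\emptyset=U_0\subset U_1\subset\dots\subset U_m=J$ of realizable subsets of $C(n,k)$ with $|U_j\setminus U_{j-1}|=1$, identified with the total order on $J$ in which elements are listed in the order they are added. An admissible $J$-order is a total order on $J$ inducing the antilexicographic order on $P_X\cap J$ for $X\in J_s$, the lexicographic order on $P_X\cap J$ for $X\in J_p$, and the lexicographic or antilexicographic order on $P_X$ for $X\in J_F$. -}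

module Defs where

open import Data.Nat using (ℕ; _<_; _≤_)
open import Data.List using (List; []; _∷_; _++_; take; length)
open import Data.List.Membership.Propositional using (_∈_)
open import Data.List.Relation.Unary.All using (All)
open import Data.List.Relation.Unary.Linked using (Linked)
open import Data.List.Relation.Unary.Unique.Propositional using (Unique)
open import Data.List.Relation.Binary.Permutation.Propositional using (_↭_)
open import Data.Product using (Σ; _×_; ∃)
open import Data.Sum using (_⊎_)
open import Relation.Binary.PropositionalEquality using (_≡_)
open import Relation.Nullary using (¬_)

-- A k-subset of {1,…,n} is represented by its elements listed in
-- strictly increasing order.
Elt : ℕ → ℕ → Set
Elt n i = (1 ≤ i) × (i ≤ n)

InC : ℕ → ℕ → List ℕ → Set
InC n k X = Linked _<_ X × All (Elt n) X × length X ≡ k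

data LexLt : List ℕ → List ℕ → Set where
  halt  : ∀ {y ys} → LexLt [] (y ∷ ys)
  here  : ∀ {x y xs ys} → x < y → LexLt (x ∷ xs) (y ∷ ys)
  there : ∀ {x xs ys} → LexLt xs ys → LexLt (x ∷ xs) (x ∷ ys)

InP : ℕ → ℕ → List ℕ → List ℕ → Set
InP n k X Y = InC n k Y × All (_∈ X) Y

KSet : Set
KSet = List (List ℕ)

IsPrefixIn : ℕ → ℕ → List ℕ → KSet → Set
IsPrefixIn n k X A = ∀ Y Y' → InP n k X Y → InP n k X Y' →
  LexLt Y Y' → Y' ∈ A → Y ∈ A

IsSuffixIn : ℕ → ℕ → List ℕ → KSet → Set
IsSuffixIn n k X A = ∀ Y Y' → InP n k X Y → InP n k X Y' →
  LexLt Y Y' → Y ∈ A → Y' ∈ A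

Realizable : ℕ → ℕ → KSet → Set
Realizable n k A = ∀ X → InC n (Data.Nat.suc k) X →
  IsPrefixIn n k X A ⊎ IsSuffixIn n k X A

NonemptyIn : ℕ → ℕ → List ℕ → KSet → Set
NonemptyIn n k X A = ∃ λ Y → InP n k X Y × Y ∈ A

FullIn : ℕ → ℕ → List ℕ → KSet → Set
FullIn n k X A = ∀ Y → InP n k X Y → Y ∈ A

InAp : ℕ → ℕ → KSet → List ℕ → Set
InAp n k A X = InC n (Data.Nat.suc k) X × IsPrefixIn n k X A ×
  NonemptyIn n k X A × ¬ FullIn n k X A

InAs : ℕ → ℕ → KSet → List ℕ → Set
InAs n k A X = InC n (Data.Nat.suc k) X × IsSuffixIn n k X A ×
  NonemptyIn n k X A × ¬ FullIn n k X A

InAF : ℕ → ℕ → KSet → List ℕ → Set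
InAF n k A X = InC n (Data.Nat.suc k) X × FullIn n k X A

Before : KSet → List ℕ → List ℕ → Set
Before L a b = Σ KSet λ L₁ → Σ KSet λ L₂ → (L ≡ L₁ ++ (a ∷ L₂)) × (b ∈ L₂)

-- a total order on J: a list enumerating J without repetition
IsOrderOn : KSet → KSet → Set
IsOrderOn J L = L ↭ J

LexOn : ℕ → ℕ → List ℕ → KSet → KSet → Set
LexOn n k X J L = ∀ Y Y' → InP n k X Y → InP n k X Y' → Y ∈ J → Y' ∈ J →
  LexLt Y Y' → Before L Y Y'

AntiLexOn : ℕ → ℕ → List ℕ → KSet → KSet → Set
AntiLexOn n k X J L = ∀ Y Y' → InP n k X Y → InP n k X Y' → Y ∈ J → Y' ∈ J →
  LexLt Y Y' → Before L Y' Y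

Admissible : ℕ → ℕ → KSet → KSet → Set
Admissible n k J L = IsOrderOn J L ×
  (∀ X → InAs n k J X → AntiLexOn n k X J L) ×
  (∀ X → InAp n k J X → LexOn n k X J L) ×
  (∀ X → InAF n k J X → LexOn n k X J L ⊎ AntiLexOn n k X J L)

-- a path from ∅ to J in B(n,k-1), recorded by the order in which the
-- elements of J are added: every prefix (initial chain set) is realizable
IsPath : ℕ → ℕ → KSet → KSet → Set
IsPath n k J L = IsOrderOn J L × (∀ m → Realizable n k (take m L))

{-# OPTIONS --safe #-}
-- Both directions are checked one (k+1)-set X at a time, through the cuts take m L of L.
-- A descent of L on P_X (Y <lex Y' with Y' listed first) is separated by some cut, which must
-- then be a suffix of P_X; if J meets P_X in a proper prefix, that suffix and J would overlap
-- and so cover P_X.  If P_X ⊆ J, the cut ending at the first element F of P_X in L meets P_X in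
-- F alone, so F is the least or the greatest element of P_X, and then no cut can separate a
-- descent (resp. an ascent).  Conversely, when J is a prefix at X and L has no descent there,
-- every cut is again a prefix; a descent forces, by admissibility, P_X ⊆ J with L
-- antilexicographic on it, and then every cut is a suffix.
module Submission where

open import Defs
open import Data.Nat using (ℕ; zero; suc; _≤_; _<?_; _≤?_; <-cmp) renaming (_≟_ to _≟ℕ_)
open import Data.Nat.Properties using (<-irrefl; <-asym)
open import Data.List using (List; []; _∷_; take; length)
open import Data.List.Properties using (≡-dec)
open import Data.List.Relation.Unary.All using (All; all?; lookup)
open import Data.List.Relation.Unary.Any using (Any; here; there; any?)
open import Data.List.Relation.Unary.Linked using (linked?)
open import Data.List.Relation.Unary.AllPairs using (_∷_)
open import Data.List.Relation.Unary.Unique.Propositional using (Unique)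
open import Data.List.Relation.Binary.Permutation.Propositional using (_↭_; ↭-sym; ↭⇒↭ₛ)
open import Data.List.Relation.Binary.Permutation.Propositional.Properties using (∈-resp-↭)
open import Data.List.Relation.Binary.Permutation.Setoid.Properties using (Unique-resp-↭)
open import Data.List.Relation.Binary.Sublist.Propositional
  using () renaming (lookup to sublist-lookup)
open import Data.List.Relation.Binary.Sublist.Propositional.Properties using (take-⊆)
open import Data.List.Membership.Propositional using (_∈_; _∉_; find; lose)
import Data.List.Membership.DecPropositional as DecMembership
open import Data.Product using (_×_; _,_; ∃; ∃₂)
open import Data.Sum using (_⊎_; inj₁; inj₂; [_,_]′)
open import Data.Empty using (⊥-elim)
open import Function using (id; _∘_)
open import Relation.Nullary using (¬_; Dec; yes; no)
open import Relation.Nullary.Decidable using (_×-dec_; map′; decidable-stable)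
open import Relation.Nullary.Negation using (¬¬-map)
open import Relation.Unary using (Decidable)
open import Relation.Binary.Definitions using (DecidableEquality; tri<; tri≈; tri>)
open import Relation.Binary.PropositionalEquality using (_≡_; _≢_; refl; sym; cong; setoid)

_≟_ : DecidableEquality (List ℕ)
_≟_ = ≡-dec _≟ℕ_

open DecMembership _≟_ using (_∈?_)

lex-irrefl : ∀ {a} → ¬ LexLt a a
lex-irrefl (here x<x) = <-irrefl refl x<x
lex-irrefl (there a<a) = lex-irrefl a<a

lex-asym : ∀ {a b} → LexLt a b → ¬ LexLt b a
lex-asym halt ()
lex-asym (here x<y) (here y<x) = <-asym x<y y<x
lex-asym (here x<x) (there _) = <-irrefl refl x<x
lex-asym (there _) (here x<x) = <-irrefl refl x<x
lex-asym (there a<b) (there b<a) = lex-asym a<b b<a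

lex⇒≢ : ∀ {a b} → LexLt a b → a ≢ b
lex⇒≢ a<a refl = lex-irrefl a<a

lex-trichotomy : ∀ a b → LexLt a b ⊎ a ≡ b ⊎ LexLt b a
lex-trichotomy [] [] = inj₂ (inj₁ refl)
lex-trichotomy [] (y ∷ b) = inj₁ halt
lex-trichotomy (x ∷ a) [] = inj₂ (inj₂ halt)
lex-trichotomy (x ∷ a) (y ∷ b) with <-cmp x y
... | tri< x<y _ _ = inj₁ (here x<y)
... | tri> _ _ y<x = inj₂ (inj₂ (here y<x))
... | tri≈ _ refl _ with lex-trichotomy a b
...   | inj₁ a<b = inj₁ (there a<b)
...   | inj₂ (inj₁ a≡b) = inj₂ (inj₁ (cong (x ∷_) a≡b))
...   | inj₂ (inj₂ b<a) = inj₂ (inj₂ (there b<a))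

lex? : ∀ a b → Dec (LexLt a b)
lex? a b with lex-trichotomy a b
... | inj₁ a<b = yes a<b
... | inj₂ (inj₁ refl) = no lex-irrefl
... | inj₂ (inj₂ b<a) = no (lex-asym b<a)

before-[] : ∀ {a b} → ¬ Before [] a b
before-[] ([] , _ , () , _)
before-[] (_ ∷ _ , _ , () , _)

before-∷ : ∀ {x L a b} → Before L a b → Before (x ∷ L) a b
before-∷ (L₁ , L₂ , refl , b∈L₂) = _ ∷ L₁ , L₂ , refl , b∈L₂

before-∷⁻ : ∀ {x L a b} → Before (x ∷ L) a b → (x ≡ a × b ∈ L) ⊎ Before L a b
before-∷⁻ ([] , L₂ , refl , b∈L₂) = inj₁ (refl , b∈L₂)
before-∷⁻ (_ ∷ L₁ , L₂ , refl , b∈L₂) = inj₂ (L₁ , L₂ , refl , b∈L₂)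

before⇒∈ˡ : ∀ {L a b} → Before L a b → a ∈ L
before⇒∈ˡ ([] , _ , refl , _) = here refl
before⇒∈ˡ (_ ∷ L₁ , L₂ , refl , b∈L₂) = there (before⇒∈ˡ (L₁ , L₂ , refl , b∈L₂))

before⇒∈ʳ : ∀ {L a b} → Before L a b → b ∈ L
before⇒∈ʳ ([] , _ , refl , b∈L₂) = there b∈L₂
before⇒∈ʳ (_ ∷ L₁ , L₂ , refl , b∈L₂) = there (before⇒∈ʳ (L₁ , L₂ , refl , b∈L₂))

before-total : ∀ {L a b} → a ∈ L → b ∈ L → a ≢ b → Before L a b ⊎ Before L b a
before-total (here refl) (here refl) a≢b = ⊥-elim (a≢b refl)
before-total (here refl) (there b∈L) _ = inj₁ ([] , _ , refl , b∈L)
before-total (there a∈L) (here refl) _ = inj₂ ([] , _ , refl , a∈L)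
before-total (there a∈L) (there b∈L) a≢b with before-total a∈L b∈L a≢b
... | inj₁ ab = inj₁ (before-∷ ab)
... | inj₂ ba = inj₂ (before-∷ ba)

before-asym : ∀ {L a b} → Unique L → Before L a b → ¬ Before L b a
before-asym {[]} _ ab _ = before-[] ab
before-asym {x ∷ L} (x∉L ∷ L-unique) ab ba with before-∷⁻ ab | before-∷⁻ ba
... | inj₁ (refl , b∈L) | inj₁ (x≡b , _) = lookup x∉L b∈L x≡b
... | inj₁ (refl , _) | inj₂ ba′ = lookup x∉L (before⇒∈ʳ ba′) refl
... | inj₂ ab′ | inj₁ (refl , _) = lookup x∉L (before⇒∈ʳ ab′) refl
... | inj₂ ab′ | inj₂ ba′ = before-asym L-unique ab′ ba′

before? : ∀ L a b → Dec (Before L a b)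
before? [] a b = no before-[]
before? (x ∷ L) a b with (x ≟ a) ×-dec (b ∈? L) | before? L a b
... | yes (refl , b∈L) | _ = yes ([] , L , refl , b∈L)
... | no _ | yes ab = yes (before-∷ ab)
... | no ¬first | no ¬ab = no ([ ¬first , ¬ab ]′ ∘ before-∷⁻)

before-take : ∀ {L a b} → Unique L → Before L a b → ∀ m → b ∈ take m L → a ∈ take m L
before-take {x ∷ L} (x∉L ∷ L-unique) ab (suc m) b∈ with before-∷⁻ ab | b∈
... | inj₁ (refl , _) | _ = here refl
... | inj₂ ab′ | here refl = ⊥-elim (lookup x∉L (before⇒∈ʳ ab′) refl)
... | inj₂ ab′ | there b∈′ = there (before-take L-unique ab′ m b∈′)

before-separated : ∀ {L a b} → Unique L → Before L a b → ∃ λ m → a ∈ take m L × b ∉ take m L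
before-separated {[]} _ ab = ⊥-elim (before-[] ab)
before-separated {x ∷ L} (x∉L ∷ L-unique) ab with before-∷⁻ ab
... | inj₁ (refl , b∈L) = 1 , here refl , λ { (here refl) → lookup x∉L b∈L refl ; (there ()) }
... | inj₂ ab′ with before-separated L-unique ab′
...   | m , a∈ , b∉ = suc m , there a∈ , λ { (here refl) → lookup x∉L (before⇒∈ʳ ab′) refl
                                          ; (there b∈) → b∉ b∈ }

record FirstIn {A : Set} (P : A → Set) (L : List A) : Set where
  field
    elem     : A
    holds    : P elem
    cut      : ℕ
    ∈cut     : elem ∈ take cut L
    only     : ∀ {y} → y ∈ take cut L → P y → y ≡ elem
    precedes : ∀ m {y} → y ∈ take m L → P y → elem ∈ take m L

first? : ∀ {A : Set} {P : A → Set} → Decidable P → (L : List A) →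
         (∀ {y} → y ∈ L → ¬ P y) ⊎ FirstIn P L
first? P? [] = inj₁ λ ()
first? P? (x ∷ L) with P? x | first? P? L
... | yes px | _ = inj₂ record
  { elem = x ; holds = px ; cut = 1 ; ∈cut = here refl
  ; only = λ { (here refl) _ → refl ; (there ()) _ }
  ; precedes = λ { zero () _ ; (suc m) _ _ → here refl } }
... | no ¬px | inj₁ none = inj₁ λ { (here refl) → ¬px ; (there y∈L) → none y∈L }
... | no ¬px | inj₂ F = inj₂ record
  { elem = elem ; holds = holds ; cut = suc cut ; ∈cut = there ∈cut
  ; only = λ { (here refl) py → ⊥-elim (¬px py) ; (there y∈) py → only y∈ py }
  ; precedes = λ { zero () _
                 ; (suc m) (here refl) py → ⊥-elim (¬px py)
                 ; (suc m) (there y∈) py → there (precedes m y∈ py) } }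
  where open FirstIn F

inC? : ∀ n k Y → Dec (InC n k Y)
inC? n k Y = linked? _<?_ Y ×-dec all? (λ i → (1 ≤? i) ×-dec (i ≤? n)) Y ×-dec (length Y ≟ℕ k)

inP? : ∀ n k X Y → Dec (InP n k X Y)
inP? n k X Y = inC? n k Y ×-dec all? (λ y → any? (y ≟ℕ_) X) Y

module _ {n k : ℕ} {X : List ℕ} where

  prefix-suffix-cover : ∀ {A B Y} → IsPrefixIn n k X A → IsSuffixIn n k X B →
                        InP n k X Y → Y ∈ A → Y ∈ B → ∀ Z → InP n k X Z → Z ∈ A ⊎ Z ∈ B
  prefix-suffix-cover {Y = Y} pre suf pY Y∈A Y∈B Z pZ with lex-trichotomy Z Y
  ... | inj₁ Z<Y = inj₁ (pre Z _ pZ pY Z<Y Y∈A)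
  ... | inj₂ (inj₁ refl) = inj₁ Y∈A
  ... | inj₂ (inj₂ Y<Z) = inj₂ (suf _ Z pY pZ Y<Z Y∈B)

  full⇒prefix : ∀ {A} → FullIn n k X A → IsPrefixIn n k X A
  full⇒prefix full Y _ pY _ _ _ = full Y pY

  full⇒suffix : ∀ {A} → FullIn n k X A → IsSuffixIn n k X A
  full⇒suffix full _ Y' _ pY' _ _ = full Y' pY'

  prefix-stable : ∀ A → ¬ ¬ IsPrefixIn n k X A → IsPrefixIn n k X A
  prefix-stable A ¬¬pre Y Y' pY pY' Y<Y' Y'∈A =
    decidable-stable (Y ∈? A) (¬¬-map (λ pre → pre Y Y' pY pY' Y<Y' Y'∈A) ¬¬pre)

  suffix-stable : ∀ A → ¬ ¬ IsSuffixIn n k X A → IsSuffixIn n k X A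
  suffix-stable A ¬¬suf Y Y' pY pY' Y<Y' Y∈A =
    decidable-stable (Y' ∈? A) (¬¬-map (λ suf → suf Y Y' pY pY' Y<Y' Y∈A) ¬¬suf)

bounded-∃₂? : ∀ {A : Set} {R : A → A → Set} (L : List A) → (∀ a b → Dec (R a b)) →
              (∀ {a b} → R a b → a ∈ L × b ∈ L) → Dec (∃₂ R)
bounded-∃₂? {R = R} L R? within = map′ witness bounded (any? (λ a → any? (R? a) L) L)
  where
  witness : Any (λ a → Any (R a) L) L → ∃₂ R
  witness any with find any
  ... | a , _ , any′ with find any′
  ...   | b , _ , r = a , b , r
  bounded : ∃₂ R → Any (λ a → Any (R a) L) L
  bounded (a , b , r) with within r
  ... | a∈L , b∈L = lose a∈L (lose b∈L r)

module OrderOn (n k : ℕ) {J L : KSet} (L↭J : L ↭ J) (J-unique : Unique J) where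

  L-unique : Unique L
  L-unique = Unique-resp-↭ (setoid _) (↭⇒↭ₛ (↭-sym L↭J)) J-unique

  ∈J⇒∈L : ∀ {Y} → Y ∈ J → Y ∈ L
  ∈J⇒∈L = ∈-resp-↭ (↭-sym L↭J)

  ∈L⇒∈J : ∀ {Y} → Y ∈ L → Y ∈ J
  ∈L⇒∈J = ∈-resp-↭ L↭J

  ∈take⇒∈J : ∀ m {Y} → Y ∈ take m L → Y ∈ J
  ∈take⇒∈J m = ∈L⇒∈J ∘ sublist-lookup (take-⊆ m L)

  IsDescent IsAscent : List ℕ → List ℕ → List ℕ → Set
  IsDescent X Y Y' = InP n k X Y × InP n k X Y' × LexLt Y Y' × Before L Y' Y
  IsAscent  X Y Y' = InP n k X Y × InP n k X Y' × LexLt Y Y' × Before L Y Y'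

  Descent Ascent : List ℕ → Set
  Descent X = ∃₂ (IsDescent X)
  Ascent  X = ∃₂ (IsAscent X)

  descent? : ∀ X → Dec (Descent X)
  descent? X = bounded-∃₂? L
    (λ Y Y' → inP? n k X Y ×-dec inP? n k X Y' ×-dec lex? Y Y' ×-dec before? L Y' Y)
    (λ (_ , _ , _ , Y'≺Y) → before⇒∈ʳ Y'≺Y , before⇒∈ˡ Y'≺Y)

  ascent? : ∀ X → Dec (Ascent X)
  ascent? X = bounded-∃₂? L
    (λ Y Y' → inP? n k X Y ×-dec inP? n k X Y' ×-dec lex? Y Y' ×-dec before? L Y Y')
    (λ (_ , _ , _ , Y≺Y') → before⇒∈ˡ Y≺Y' , before⇒∈ʳ Y≺Y')

  lexOn-if-no-descent : ∀ {X} → ¬ Descent X → LexOn n k X J L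
  lexOn-if-no-descent no-descent Y Y' pY pY' Y∈J Y'∈J Y<Y'
    with before-total (∈J⇒∈L Y∈J) (∈J⇒∈L Y'∈J) (lex⇒≢ Y<Y')
  ... | inj₁ Y≺Y' = Y≺Y'
  ... | inj₂ Y'≺Y = ⊥-elim (no-descent (Y , Y' , pY , pY' , Y<Y' , Y'≺Y))

  antiLexOn-if-no-ascent : ∀ {X} → ¬ Ascent X → AntiLexOn n k X J L
  antiLexOn-if-no-ascent no-ascent Y Y' pY pY' Y∈J Y'∈J Y<Y'
    with before-total (∈J⇒∈L Y∈J) (∈J⇒∈L Y'∈J) (lex⇒≢ Y<Y')
  ... | inj₁ Y≺Y' = ⊥-elim (no-ascent (Y , Y' , pY , pY' , Y<Y' , Y≺Y'))
  ... | inj₂ Y'≺Y = Y'≺Y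

  no-descent-if-lexOn : ∀ {X} → LexOn n k X J L → ¬ Descent X
  no-descent-if-lexOn lex (Y , Y' , pY , pY' , Y<Y' , Y'≺Y) = before-asym L-unique
    (lex Y Y' pY pY' (∈L⇒∈J (before⇒∈ʳ Y'≺Y)) (∈L⇒∈J (before⇒∈ˡ Y'≺Y)) Y<Y') Y'≺Y

  no-ascent-if-antiLexOn : ∀ {X} → AntiLexOn n k X J L → ¬ Ascent X
  no-ascent-if-antiLexOn anti (Y , Y' , pY , pY' , Y<Y' , Y≺Y') = before-asym L-unique
    (anti Y Y' pY pY' (∈L⇒∈J (before⇒∈ˡ Y≺Y')) (∈L⇒∈J (before⇒∈ʳ Y≺Y')) Y<Y') Y≺Y'

  prefix-cut : ∀ {X} → IsPrefixIn n k X J → LexOn n k X J L → ∀ m → IsPrefixIn n k X (take m L)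
  prefix-cut J-prefix lex m Y Y' pY pY' Y<Y' Y'∈cut =
    before-take L-unique (lex Y Y' pY pY' Y∈J Y'∈J Y<Y') m Y'∈cut
    where
    Y'∈J : Y' ∈ J
    Y'∈J = ∈take⇒∈J m Y'∈cut
    Y∈J : Y ∈ J
    Y∈J = J-prefix Y Y' pY pY' Y<Y' Y'∈J

  suffix-cut : ∀ {X} → IsSuffixIn n k X J → AntiLexOn n k X J L → ∀ m → IsSuffixIn n k X (take m L)
  suffix-cut J-suffix anti m Y Y' pY pY' Y<Y' Y∈cut =
    before-take L-unique (anti Y Y' pY pY' Y∈J Y'∈J Y<Y') m Y∈cut
    where
    Y∈J : Y ∈ J
    Y∈J = ∈take⇒∈J m Y∈cut
    Y'∈J : Y' ∈ J
    Y'∈J = J-suffix Y Y' pY pY' Y<Y' Y∈J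

  module FromPath (path : ∀ m → Realizable n k (take m L)) where

    descent-suffix-cut : ∀ {X Y Y'} → InC n (suc k) X → IsDescent X Y Y' →
                         ∃ λ m → Y' ∈ take m L × Y ∉ take m L × IsSuffixIn n k X (take m L)
    descent-suffix-cut {X} cx (pY , pY' , Y<Y' , Y'≺Y) with before-separated L-unique Y'≺Y
    ... | m , Y'∈cut , Y∉cut with path m X cx
    ...   | inj₁ prefix = ⊥-elim (Y∉cut (prefix _ _ pY pY' Y<Y' Y'∈cut))
    ...   | inj₂ suffix = m , Y'∈cut , Y∉cut , suffix

    ascent-prefix-cut : ∀ {X Y Y'} → InC n (suc k) X → IsAscent X Y Y' →
                        ∃ λ m → Y ∈ take m L × Y' ∉ take m L × IsPrefixIn n k X (take m L)
    ascent-prefix-cut {X} cx (pY , pY' , Y<Y' , Y≺Y') with before-separated L-unique Y≺Y'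
    ... | m , Y∈cut , Y'∉cut with path m X cx
    ...   | inj₁ prefix = m , Y∈cut , Y'∉cut , prefix
    ...   | inj₂ suffix = ⊥-elim (Y'∉cut (suffix _ _ pY pY' Y<Y' Y∈cut))

    lexOn-Ap : ∀ X → InAp n k J X → LexOn n k X J L
    lexOn-Ap X (cx , J-prefix , _ , not-full) =
      lexOn-if-no-descent λ (_ , _ , d@(_ , pY' , _ , Y'≺Y)) →
      let m , Y'∈cut , _ , suffix = descent-suffix-cut cx d in
      not-full λ Z pZ → [ id , ∈take⇒∈J m ]′
        (prefix-suffix-cover J-prefix suffix pY' (∈L⇒∈J (before⇒∈ˡ Y'≺Y)) Y'∈cut Z pZ)

    antiLexOn-As : ∀ X → InAs n k J X → AntiLexOn n k X J L
    antiLexOn-As X (cx , J-suffix , _ , not-full) =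
      antiLexOn-if-no-ascent λ (_ , _ , a@(pY , _ , _ , Y≺Y')) →
      let m , Y∈cut , _ , prefix = ascent-prefix-cut cx a in
      not-full λ Z pZ → [ ∈take⇒∈J m , id ]′
        (prefix-suffix-cover prefix J-suffix pY Y∈cut (∈L⇒∈J (before⇒∈ˡ Y≺Y')) Z pZ)

    open FirstIn

    no-descent-if-first-prefix : ∀ {X} → InC n (suc k) X → (F : FirstIn (InP n k X) L) →
                                 IsPrefixIn n k X (take (cut F) L) → ¬ Descent X
    no-descent-if-first-prefix cx F prefix (Y , _ , d@(pY , pY' , _ , _))
      with descent-suffix-cut cx d | lex-trichotomy (elem F) Y
    ... | m , Y'∈cut , Y∉cut , suffix | inj₁ F<Y =
      Y∉cut (suffix _ _ (holds F) pY F<Y (precedes F m Y'∈cut pY'))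
    ... | m , Y'∈cut , Y∉cut , _ | inj₂ (inj₁ refl) = Y∉cut (precedes F m Y'∈cut pY')
    ... | _ | inj₂ (inj₂ Y<F) = lex⇒≢ Y<F (only F (prefix _ _ pY (holds F) Y<F (∈cut F)) pY)

    no-ascent-if-first-suffix : ∀ {X} → InC n (suc k) X → (F : FirstIn (InP n k X) L) →
                                IsSuffixIn n k X (take (cut F) L) → ¬ Ascent X
    no-ascent-if-first-suffix cx F suffix (_ , Y' , a@(pY , pY' , _ , _))
      with ascent-prefix-cut cx a | lex-trichotomy Y' (elem F)
    ... | m , Y∈cut , Y'∉cut , prefix | inj₁ Y'<F =
      Y'∉cut (prefix _ _ pY' (holds F) Y'<F (precedes F m Y∈cut pY))
    ... | m , Y∈cut , Y'∉cut , _ | inj₂ (inj₁ refl) = Y'∉cut (precedes F m Y∈cut pY)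
    ... | _ | inj₂ (inj₂ F<Y') =
      lex⇒≢ F<Y' (sym (only F (suffix _ _ (holds F) pY' F<Y' (∈cut F)) pY'))

    lexOn⊎antiLexOn : ∀ X → InC n (suc k) X → LexOn n k X J L ⊎ AntiLexOn n k X J L
    lexOn⊎antiLexOn X cx with first? (inP? n k X) L
    ... | inj₁ none = inj₁ λ Y _ pY _ Y∈J _ _ → ⊥-elim (none (∈J⇒∈L Y∈J) pY)
    ... | inj₂ F with path (cut F) X cx
    ...   | inj₁ prefix = inj₁ (lexOn-if-no-descent (no-descent-if-first-prefix cx F prefix))
    ...   | inj₂ suffix = inj₂ (antiLexOn-if-no-ascent (no-ascent-if-first-suffix cx F suffix))

    admissible : Admissible n k J L
    admissible = L↭J , antiLexOn-As , lexOn-Ap , λ X (cx , _) → lexOn⊎antiLexOn X cx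

  module FromAdmissible (J-realizable : Realizable n k J)
                        (antiLexOn-As : ∀ X → InAs n k J X → AntiLexOn n k X J L)
                        (lexOn-Ap : ∀ X → InAp n k J X → LexOn n k X J L)
                        (monotone-AF : ∀ X → InAF n k J X → LexOn n k X J L ⊎ AntiLexOn n k X J L)
                        where

    full-if-descent : ∀ {X} → InC n (suc k) X → IsPrefixIn n k X J → Descent X →
                      ¬ ¬ FullIn n k X J
    full-if-descent cx J-prefix d@(_ , Y' , _ , pY' , _ , Y'≺Y) not-full =
      no-descent-if-lexOn (lexOn-Ap _ (cx , J-prefix , nonempty , not-full)) d
      where
      nonempty : NonemptyIn n k _ J
      nonempty = Y' , pY' , ∈L⇒∈J (before⇒∈ˡ Y'≺Y)

    full-if-ascent : ∀ {X} → InC n (suc k) X → IsSuffixIn n k X J → Ascent X →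
                     ¬ ¬ FullIn n k X J
    full-if-ascent cx J-suffix a@(Y , _ , pY , _ , _ , Y≺Y') not-full =
      no-ascent-if-antiLexOn (antiLexOn-As _ (cx , J-suffix , nonempty , not-full)) a
      where
      nonempty : NonemptyIn n k _ J
      nonempty = Y , pY , ∈L⇒∈J (before⇒∈ˡ Y≺Y')

    antiLexOn-if-full-descent : ∀ {X} → InC n (suc k) X → FullIn n k X J → Descent X →
                                AntiLexOn n k X J L
    antiLexOn-if-full-descent cx full d with monotone-AF _ (cx , full)
    ... | inj₁ lex = ⊥-elim (no-descent-if-lexOn lex d)
    ... | inj₂ anti = anti

    lexOn-if-full-ascent : ∀ {X} → InC n (suc k) X → FullIn n k X J → Ascent X → LexOn n k X J L
    lexOn-if-full-ascent cx full a with monotone-AF _ (cx , full)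
    ... | inj₁ lex = lex
    ... | inj₂ anti = ⊥-elim (no-ascent-if-antiLexOn anti a)

    path : ∀ m → Realizable n k (take m L)
    path m X cx with J-realizable X cx
    ... | inj₁ J-prefix with descent? X
    ...   | no no-descent = inj₁ (prefix-cut J-prefix (lexOn-if-no-descent no-descent) m)
    ...   | yes d = inj₂ (suffix-stable (take m L) (¬¬-map
            (λ full → suffix-cut (full⇒suffix full) (antiLexOn-if-full-descent cx full d) m)
            (full-if-descent cx J-prefix d)))
    path m X cx | inj₂ J-suffix with ascent? X
    ...   | no no-ascent = inj₂ (suffix-cut J-suffix (antiLexOn-if-no-ascent no-ascent) m)
    ...   | yes a = inj₁ (prefix-stable (take m L) (¬¬-map
            (λ full → prefix-cut (full⇒prefix full) (lexOn-if-full-ascent cx full a) m)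
            (full-if-ascent cx J-suffix a)))

theorem3p19 : (n k : ℕ) → 2 ≤ k → (J : KSet) → Unique J → All (InC n k) J →
    Realizable n k J →
    (∀ L → IsPath n k J L → Admissible n k J L) ×
    (∀ L → Admissible n k J L → IsPath n k J L)
theorem3p19 n k _ J J-unique _ J-realizable =
  (λ L (L↭J , path) → OrderOn.FromPath.admissible n k L↭J J-unique path) ,
  (λ L (L↭J , antiLexOn-As , lexOn-Ap , monotone-AF) → L↭J ,
    OrderOn.FromAdmissible.path n k L↭J J-unique J-realizable antiLexOn-As lexOn-Ap monotone-AF)
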